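{- For every $R$, the following properties are equivalent: (1) $R$ is connected and $R^*=R^{\top*}$; (2) $R^{\top}\mathbin{;}\mathsf{L}\mathbin{;}R^{\top}\subseteq R^*$; (3) $R^{\top}\mathbin{;}\mathsf{L}\mathbin{;}R^{\top}\subseteq R^+$; (4) $R^{\top}\mathbin{;}\mathsf{L}\mathbin{;}R^{\top}=R^+$; (5) $R^{\top}\mathbin{;}\mathsf{L}\mathbin{;}R=R^+$; (6) $R\mathbin{;}\mathsf{L}\mathbin{;}R^{\top}=R^+$. They imply each of: (7) $R^{\top}\mathbin{;}\mathsf{L}\mathbin{;}R\subseteq R^+$; (8) $R\mathbin{;}\mathsf{L}\mathbin{;}R^{\top}\subseteq R^+$; (9) $R\mathbin{;}\mathsf{L}\mathbin{;}R\subseteq R\mathbin{;}R^+$; (10) $R\mathbin{;}\mathsf{L}\mathbin{;}R\subseteq R^+$. If $R$ is injective, (7) is equivalent to (1). If $R$ is univalent, (8) is equivalent to (1). If $R$ is both injective and univalent, (9) is equivalent to (1).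
   Context: $(B,\cup,\mathbin{;},\overline{\,\cdot\,},{}^{\top},{}^{*},\mathsf{I})$ is a Kleene relation algebra; all variables range over $B$. That is, $(B,\cup,\mathbin{;},\overline{\,\cdot\,},{}^{\top},\mathsf{I})$ is a relation algebra: $\cup$ is associative and commutative and $R=\overline{\overline{R}\cup\overline{S}}\cup\overline{\overline{R}\cup S}$; $\mathbin{;}$ is associative, $(R\cup S)\mathbin{;}T=R\mathbin{;}T\cup S\mathbin{;}T$, $R\mathbin{;}\mathsf{I}=R$; $(R^{\top})^{\top}=R$, $(R\cup S)^{\top}=R^{\top}\cup S^{\top}$, $(R\mathbin{;}S)^{\top}=S^{\top}\mathbin{;}R^{\top}$; $R^{\top}\mathbin{;}\overline{R\mathbin{;}S}\cup\overline{S}=\overline{S}$. The order is $R\subseteq S$ iff $R\cup S=S$; $R\cap S=\overline{\overline{R}\cup\overline{S}}$; $\mathsf{L}=R\cup\overline{R}$ is the greatest and $\mathsf{O}=R\cap\overline{R}$ the least element. The star satisfies $\mathsf{I}\cup R\mathbin{;}R^*\subseteq R^*$, $\mathsf{I}\cup R^*\mathbin{;}R\subseteq R^*$, $S\cup R\mathbin{;}Q\subseteq Q\Rightarrow R^*\mathbin{;}S\subseteq Q$, $S\cup Q\mathbin{;}R\subseteq Q\Rightarrow S\mathbin{;}R^*\subseteq Q$. Write $R^+=R\mathbin{;}R^*$ and $R^{\top*}=(R^{\top})^*$. The algebra satisfies the Tarski rule ($R\neq\mathsf{O}$ iff $\mathsf{L}\mathbin{;}R\mathbin{;}\mathsf{L}=\mathsf{L}$)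 and the point axiom (for every $R\neq\mathsf{O}$ there are points $p,q$ with $p\mathbin{;}q^{\top}\subseteq R$), where a point is an element $p$ with $p=p\mathbin{;}\mathsf{L}$, $p\mathbin{;}p^{\top}\subseteq\mathsf{I}$ and $\mathsf{I}\subseteq p^{\top}\mathbin{;}p$. Composition binds tighter than $\cup,\cap$; complement and converse bind tighter than composition. $R$ is univalent if $R^{\top}\mathbin{;}R\subseteq\mathsf{I}$ and injective if $R\mathbin{;}R^{\top}\subseteq\mathsf{I}$. $R$ is connected if $R\mathbin{;}\mathsf{L}\mathbin{;}R\subseteq R^*\cup R^{\top*}$. -}

module Defs where

open import Level using (Level; suc)
open import Relation.Binary.PropositionalEquality using (_≡_)
open import Relation.Nullary using (¬_)
open import Data.Product using (_×_; ∃₂)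
open import Function.Bundles using (_⇔_)

record KleeneRelationAlgebra (c : Level) : Set (suc c) where
  infixl 6 _∪_ _∩_
  infixl 7 _⨾_
  infix  9 ∁_
  infixl 10 _ᵀ _⋆
  infix 4 _⊆_
  field
    Carrier : Set c
    _∪_     : Carrier → Carrier → Carrier
    _⨾_     : Carrier → Carrier → Carrier
    ∁_      : Carrier → Carrier
    _ᵀ      : Carrier → Carrier
    _⋆      : Carrier → Carrier
    I       : Carrier

  _⊆_ : Carrier → Carrier → Set c
  R ⊆ S = R ∪ S ≡ S

  _∩_ : Carrier → Carrier → Carrier
  R ∩ S = ∁ (∁ R ∪ ∁ S)

  -- L = R ∪ ∁ R (independent of R by the axioms); we take R = I
  L : Carrier
  L = I ∪ ∁ I

  O : Carrier
  O = I ∩ ∁ I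

  isPoint : Carrier → Set c
  isPoint p = (p ≡ p ⨾ L) × (p ⨾ p ᵀ ⊆ I) × (I ⊆ p ᵀ ⨾ p)

  field
    ∪-assoc    : ∀ R S T → (R ∪ S) ∪ T ≡ R ∪ (S ∪ T)
    ∪-comm     : ∀ R S → R ∪ S ≡ S ∪ R
    huntington : ∀ R S → R ≡ ∁ (∁ R ∪ ∁ S) ∪ ∁ (∁ R ∪ S)
    ⨾-assoc    : ∀ R S T → (R ⨾ S) ⨾ T ≡ R ⨾ (S ⨾ T)
    ⨾-distribʳ : ∀ R S T → (R ∪ S) ⨾ T ≡ R ⨾ T ∪ S ⨾ T
    ⨾-identityʳ : ∀ R → R ⨾ I ≡ R
    ᵀ-involutive : ∀ R → (R ᵀ) ᵀ ≡ R
    ᵀ-distrib-∪  : ∀ R S → (R ∪ S) ᵀ ≡ R ᵀ ∪ S ᵀ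
    ᵀ-distrib-⨾  : ∀ R S → (R ⨾ S) ᵀ ≡ S ᵀ ⨾ R ᵀ
    schroeder    : ∀ R S → R ᵀ ⨾ ∁ (R ⨾ S) ∪ ∁ S ≡ ∁ S
    star-unfoldˡ : ∀ R → I ∪ R ⨾ R ⋆ ⊆ R ⋆
    star-unfoldʳ : ∀ R → I ∪ R ⋆ ⨾ R ⊆ R ⋆
    star-inductˡ : ∀ R S Q → S ∪ R ⨾ Q ⊆ Q → R ⋆ ⨾ S ⊆ Q
    star-inductʳ : ∀ R S Q → S ∪ Q ⨾ R ⊆ Q → S ⨾ R ⋆ ⊆ Q
    tarski       : ∀ R → (¬ (R ≡ O)) ⇔ (L ⨾ R ⨾ L ≡ L)
    point-axiom  : ∀ R → ¬ (R ≡ O) →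
                   ∃₂ λ p q → isPoint p × isPoint q × (p ⨾ q ᵀ ⊆ R)

module KRA {c : Level} (A : KleeneRelationAlgebra c) where
  open KleeneRelationAlgebra A public

  infixl 10 _⁺

  _⁺ : Carrier → Carrier
  R ⁺ = R ⨾ R ⋆

  univalent : Carrier → Set c
  univalent R = R ᵀ ⨾ R ⊆ I

  injective : Carrier → Set c
  injective R = R ⨾ R ᵀ ⊆ I

  connected : Carrier → Set c
  connected R = R ⨾ L ⨾ R ⊆ R ⋆ ∪ R ᵀ ⋆

-- Everything rests on r ⊆ r ⨾ rᵀ ⨾ r, a consequence of Schröder's law. It gives
-- Rᵀ ⊆ Rᵀ ⨾ L ⨾ Rᵀ, so (3) yields Rᵀ ⊆ R⁺ and, transposing, R ⊆ Rᵀ⁺. Then in a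
-- product X ⨾ L ⨾ Y with X, Y ∈ {R, Rᵀ} each outer factor may be traded for the other,
-- the leftover being absorbed into L: all four such products coincide and contain R⁺.
-- Conversely (5) and (6) make R⁺ symmetric, which again gives Rᵀ ⊆ R⁺. The equivalence
-- of (1) and (2) is a matter of transposition. For the weak forms (7)–(9), the extra
-- factor that r ⊆ r ⨾ rᵀ ⨾ r introduces is cancelled by R⁺ ⨾ Rᵀ ⊆ R⋆ when R is
-- injective and by Rᵀ ⨾ R⁺ ⊆ R⋆ when R is univalent.

module Submission where

open import Defs
open import Level using (Level)
open import Relation.Binary.PropositionalEquality
  using (_≡_; refl; sym; trans; cong; cong₂; subst; isEquivalence; module ≡-Reasoning)
open import Relation.Binary.Bundles using (Poset)
open import Algebra.Bundles using (CommutativeSemigroup)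
open import Data.Product using (_×_; _,_)
open import Function.Base using (_∘_)
open import Function.Bundles using (_⇔_; mk⇔; module Equivalence)
open import Function.Construct.Composition using (_⇔-∘_)
import Algebra.Properties.CommutativeSemigroup as CommutativeSemigroupProperties
import Relation.Binary.Reasoning.PartialOrder as PartialOrderReasoning

open Equivalence using (to; from)

module Properties {c : Level} (𝔸 : KleeneRelationAlgebra c) where
  open KRA 𝔸

  ∪-commutativeSemigroup : CommutativeSemigroup c c
  ∪-commutativeSemigroup = record
    { Carrier = Carrier
    ; _≈_ = _≡_
    ; _∙_ = _∪_
    ; isCommutativeSemigroup = record
      { isSemigroup = record
        { isMagma = record { isEquivalence = isEquivalence ; ∙-cong = cong₂ _∪_ }
        ; assoc = ∪-assoc
        }
      ; comm = ∪-comm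
      }
    }

  open CommutativeSemigroupProperties ∪-commutativeSemigroup using (interchange)

  ∁-involutive : ∀ x → ∁ (∁ x) ≡ x
  ∁-involutive x = begin
    b                     ≡⟨ huntington b a ⟩
    ∁ (d ∪ b) ∪ ∁ (d ∪ a) ≡⟨ cong₂ _∪_ (cong ∁_ (sym (∪-∁-swap a))) (cong ∁_ (∪-comm d a)) ⟩
    ∁ (a ∪ b) ∪ ∁ (a ∪ d) ≡⟨ ∪-comm _ _ ⟩
    ∁ (a ∪ d) ∪ ∁ (a ∪ b) ≡⟨ huntington x b ⟨
    x                     ∎
    where
      open ≡-Reasoning
      a b d : Carrier
      a = ∁ x
      b = ∁ a
      d = ∁ b
      ∪-∁-swap : ∀ y → y ∪ ∁ y ≡ ∁ (∁ y) ∪ ∁ y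
      ∪-∁-swap y = begin
        y ∪ ∁ y
          ≡⟨ cong₂ _∪_ (huntington y ∁∁y) (huntington ∁y ∁∁y) ⟩
        (∁ (∁y ∪ ∁∁∁y) ∪ ∁ (∁y ∪ ∁∁y)) ∪ (∁ (∁∁y ∪ ∁∁∁y) ∪ ∁ (∁∁y ∪ ∁∁y))
          ≡⟨ interchange _ _ _ _ ⟩
        (∁ (∁y ∪ ∁∁∁y) ∪ ∁ (∁∁y ∪ ∁∁∁y)) ∪ (∁ (∁y ∪ ∁∁y) ∪ ∁ (∁∁y ∪ ∁∁y))
          ≡⟨ cong₂ _∪_ (∪-comm _ _) (∪-comm _ _) ⟩
        (∁ (∁∁y ∪ ∁∁∁y) ∪ ∁ (∁y ∪ ∁∁∁y)) ∪ (∁ (∁∁y ∪ ∁∁y) ∪ ∁ (∁y ∪ ∁∁y))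
          ≡⟨ cong₂ _∪_ (cong₂ (λ u v → ∁ u ∪ ∁ v) (∪-comm _ _) (∪-comm _ _))
                       (cong (λ u → ∁ (∁∁y ∪ ∁∁y) ∪ ∁ u) (∪-comm _ _)) ⟩
        (∁ (∁∁∁y ∪ ∁∁y) ∪ ∁ (∁∁∁y ∪ ∁y)) ∪ (∁ (∁∁y ∪ ∁∁y) ∪ ∁ (∁∁y ∪ ∁y))
          ≡⟨ cong₂ _∪_ (huntington ∁∁y ∁y) (huntington ∁y ∁y) ⟨
        ∁∁y ∪ ∁y ∎
        where
          ∁y ∁∁y ∁∁∁y : Carrier
          ∁y = ∁ y
          ∁∁y = ∁ ∁y
          ∁∁∁y = ∁ ∁∁y

  huntington-∁ : ∀ x y → ∁ x ≡ ∁ (x ∪ ∁ y) ∪ ∁ (x ∪ y)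
  huntington-∁ x y =
    trans (huntington (∁ x) y) (cong (λ z → ∁ (z ∪ ∁ y) ∪ ∁ (z ∪ y)) (∁-involutive x))

  ∪-complementʳ : ∀ x → x ∪ ∁ x ≡ L
  ∪-complementʳ x = begin
    x ∪ ∁ x
      ≡⟨ cong₂ _∪_ (huntington x I) (huntington-∁ x I) ⟩
    (∁ (∁ x ∪ ∁ I) ∪ ∁ (∁ x ∪ I)) ∪ (∁ (x ∪ ∁ I) ∪ ∁ (x ∪ I))
      ≡⟨ interchange _ _ _ _ ⟩
    (∁ (∁ x ∪ ∁ I) ∪ ∁ (x ∪ ∁ I)) ∪ (∁ (∁ x ∪ I) ∪ ∁ (x ∪ I))
      ≡⟨ cong₂ _∪_ (cong₂ (λ u v → ∁ u ∪ ∁ v) (∪-comm _ _) (∪-comm _ _))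
                   (cong₂ (λ u v → ∁ u ∪ ∁ v) (∪-comm _ _) (∪-comm _ _)) ⟩
    (∁ (∁ I ∪ ∁ x) ∪ ∁ (∁ I ∪ x)) ∪ (∁ (I ∪ ∁ x) ∪ ∁ (I ∪ x))
      ≡⟨ cong₂ _∪_ (huntington I x) (huntington-∁ I x) ⟨
    L ∎
    where open ≡-Reasoning

  ∪-zeroʳ : ∀ x → x ∪ L ≡ L
  ∪-zeroʳ x = begin
    x ∪ L                       ≡⟨ cong (x ∪_) (∪-complementʳ x) ⟨
    x ∪ (x ∪ ∁ x)               ≡⟨ ∪-assoc x x (∁ x) ⟨
    xx ∪ ∁ x                    ≡⟨ cong (xx ∪_) (huntington-∁ x x) ⟩
    xx ∪ (∁ (x ∪ ∁ x) ∪ ∁ xx)   ≡⟨ cong (λ z → xx ∪ (∁ z ∪ ∁ xx)) (∪-complementʳ x) ⟩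
    xx ∪ (∁ L ∪ ∁ xx)           ≡⟨ cong (xx ∪_) (∪-comm _ _) ⟩
    xx ∪ (∁ xx ∪ ∁ L)           ≡⟨ ∪-assoc _ _ _ ⟨
    (xx ∪ ∁ xx) ∪ ∁ L           ≡⟨ cong (_∪ ∁ L) (∪-complementʳ xx) ⟩
    L ∪ ∁ L                     ≡⟨ ∪-complementʳ L ⟩
    L                           ∎
    where
      open ≡-Reasoning
      xx : Carrier
      xx = x ∪ x

  ∪-identityʳ : ∀ x → x ∪ ∁ L ≡ x
  ∪-identityʳ x = begin
    x ∪ ∁ L               ≡⟨ cong (_∪ ∁ L) x≡m∪∁L ⟩
    (m ∪ ∁ L) ∪ ∁ L       ≡⟨ ∪-assoc _ _ _ ⟩
    m ∪ (∁ L ∪ ∁ L)       ≡⟨ cong (m ∪_) ∁L∪∁L≡∁L ⟩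
    m ∪ ∁ L               ≡⟨ x≡m∪∁L ⟨
    x                     ∎
    where
      open ≡-Reasoning
      m : Carrier
      m = ∁ (∁ x ∪ ∁ x)
      x≡m∪∁L : x ≡ m ∪ ∁ L
      x≡m∪∁L = trans (huntington x x)
                     (cong (λ z → m ∪ ∁ z) (trans (∪-comm (∁ x) x) (∪-complementʳ x)))
      ∁L∪∁L≡∁L : ∁ L ∪ ∁ L ≡ ∁ L
      ∁L∪∁L≡∁L = begin
        ∁ L ∪ ∁ L                                   ≡⟨ cong₂ (λ u v → ∁ u ∪ ∁ v) (∪-zeroʳ L) (∪-complementʳ L) ⟨
        ∁ (L ∪ L) ∪ ∁ (L ∪ ∁ L)                     ≡⟨ cong (λ z → ∁ (z ∪ z) ∪ ∁ (z ∪ ∁ L)) (∁-involutive L) ⟨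
        ∁ (∁ (∁ L) ∪ ∁ (∁ L)) ∪ ∁ (∁ (∁ L) ∪ ∁ L) ≡⟨ huntington (∁ L) (∁ L) ⟨
        ∁ L                                         ∎

  ∪-idem : ∀ x → x ∪ x ≡ x
  ∪-idem x = begin
    x ∪ x         ≡⟨ ∁-involutive _ ⟨
    ∁ (∁ (x ∪ x)) ≡⟨ cong ∁_ ∁x≡∁[x∪x] ⟨
    ∁ (∁ x)       ≡⟨ ∁-involutive x ⟩
    x             ∎
    where
      open ≡-Reasoning
      ∁x≡∁[x∪x] : ∁ x ≡ ∁ (x ∪ x)
      ∁x≡∁[x∪x] = begin
        ∁ x                         ≡⟨ huntington-∁ x x ⟩
        ∁ (x ∪ ∁ x) ∪ ∁ (x ∪ x)     ≡⟨ cong (λ z → ∁ z ∪ ∁ (x ∪ x)) (∪-complementʳ x) ⟩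
        ∁ L ∪ ∁ (x ∪ x)             ≡⟨ ∪-comm _ _ ⟩
        ∁ (x ∪ x) ∪ ∁ L             ≡⟨ ∪-identityʳ _ ⟩
        ∁ (x ∪ x)                   ∎

  ⊆-refl : ∀ {x} → x ⊆ x
  ⊆-refl {x} = ∪-idem x

  ⊆-reflexive : ∀ {x y} → x ≡ y → x ⊆ y
  ⊆-reflexive refl = ⊆-refl

  ⊆-trans : ∀ {x y z} → x ⊆ y → y ⊆ z → x ⊆ z
  ⊆-trans {x} {y} {z} x⊆y y⊆z = begin
    x ∪ z         ≡⟨ cong (x ∪_) y⊆z ⟨
    x ∪ (y ∪ z)   ≡⟨ ∪-assoc x y z ⟨
    (x ∪ y) ∪ z   ≡⟨ cong (_∪ z) x⊆y ⟩
    y ∪ z         ≡⟨ y⊆z ⟩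
    z             ∎
    where open ≡-Reasoning

  ⊆-antisym : ∀ {x y} → x ⊆ y → y ⊆ x → x ≡ y
  ⊆-antisym {x} {y} x⊆y y⊆x = trans (sym y⊆x) (trans (∪-comm y x) x⊆y)

  ⊆-poset : Poset c c c
  ⊆-poset = record
    { Carrier = Carrier
    ; _≈_ = _≡_
    ; _≤_ = _⊆_
    ; isPartialOrder = record
      { isPreorder = record
        { isEquivalence = isEquivalence ; reflexive = ⊆-reflexive ; trans = ⊆-trans }
      ; antisym = ⊆-antisym
      }
    }

  module ⊆-Reasoning = PartialOrderReasoning ⊆-poset

  x⊆x∪y : ∀ x y → x ⊆ x ∪ y
  x⊆x∪y x y = trans (sym (∪-assoc x x y)) (cong (_∪ y) (∪-idem x))

  y⊆x∪y : ∀ x y → y ⊆ x ∪ y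
  y⊆x∪y x y = subst (y ⊆_) (∪-comm y x) (x⊆x∪y y x)

  ∪-least : ∀ {x y z} → x ⊆ z → y ⊆ z → x ∪ y ⊆ z
  ∪-least {x} {y} {z} x⊆z y⊆z = trans (∪-assoc x y z) (trans (cong (x ∪_) y⊆z) x⊆z)

  ⊆-L : ∀ x → x ⊆ L
  ⊆-L = ∪-zeroʳ

  ∁L-⊆ : ∀ x → ∁ L ⊆ x
  ∁L-⊆ x = trans (∪-comm _ _) (∪-identityʳ x)

  ∁-antitone : ∀ {x y} → x ⊆ y → ∁ y ⊆ ∁ x
  ∁-antitone {x} {y} x⊆y = subst (∁ y ⊆_) (sym ∁x≡) (y⊆x∪y _ _)
    where
      ∁x≡ : ∁ x ≡ ∁ (x ∪ ∁ y) ∪ ∁ y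
      ∁x≡ = trans (huntington-∁ x y) (cong (λ z → ∁ (x ∪ ∁ y) ∪ ∁ z) x⊆y)

  ⊆∁⇒≡∁L : ∀ {x} → x ⊆ ∁ x → x ≡ ∁ L
  ⊆∁⇒≡∁L {x} x⊆∁x = trans (sym (∁-involutive x)) (cong ∁_ (trans (sym x⊆∁x) (∪-complementʳ x)))

  x∩y⊆x : ∀ x y → x ∩ y ⊆ x
  x∩y⊆x x y = ⊆-trans (∁-antitone (x⊆x∪y (∁ x) (∁ y))) (⊆-reflexive (∁-involutive x))

  x∩y⊆y : ∀ x y → x ∩ y ⊆ y
  x∩y⊆y x y = ⊆-trans (∁-antitone (y⊆x∪y (∁ x) (∁ y))) (⊆-reflexive (∁-involutive y))

  ⨾-monoˡ : ∀ {x y} z → x ⊆ y → x ⨾ z ⊆ y ⨾ z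
  ⨾-monoˡ {x} {y} z x⊆y = trans (sym (⨾-distribʳ x y z)) (cong (_⨾ z) x⊆y)

  ᵀ-mono : ∀ {x y} → x ⊆ y → x ᵀ ⊆ y ᵀ
  ᵀ-mono {x} {y} x⊆y = trans (sym (ᵀ-distrib-∪ x y)) (cong _ᵀ x⊆y)

  ⊆ᵀ⇒ᵀ⊆ : ∀ {x y} → x ⊆ y ᵀ → x ᵀ ⊆ y
  ⊆ᵀ⇒ᵀ⊆ {x} {y} x⊆yᵀ = subst (x ᵀ ⊆_) (ᵀ-involutive y) (ᵀ-mono x⊆yᵀ)

  ᵀ⊆⇒⊆ᵀ : ∀ {x y} → x ᵀ ⊆ y → x ⊆ y ᵀ
  ᵀ⊆⇒⊆ᵀ {x} {y} xᵀ⊆y = subst (_⊆ y ᵀ) (ᵀ-involutive x) (ᵀ-mono xᵀ⊆y)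

  ⨾-distribˡ : ∀ x y z → x ⨾ (y ∪ z) ≡ x ⨾ y ∪ x ⨾ z
  ⨾-distribˡ x y z = begin
    x ⨾ (y ∪ z)                     ≡⟨ ᵀ-involutive _ ⟨
    (x ⨾ (y ∪ z)) ᵀ ᵀ               ≡⟨ cong _ᵀ (ᵀ-distrib-⨾ x (y ∪ z)) ⟩
    ((y ∪ z) ᵀ ⨾ x ᵀ) ᵀ             ≡⟨ cong (λ w → (w ⨾ x ᵀ) ᵀ) (ᵀ-distrib-∪ y z) ⟩
    ((y ᵀ ∪ z ᵀ) ⨾ x ᵀ) ᵀ           ≡⟨ cong _ᵀ (⨾-distribʳ _ _ _) ⟩
    (y ᵀ ⨾ x ᵀ ∪ z ᵀ ⨾ x ᵀ) ᵀ       ≡⟨ ᵀ-distrib-∪ _ _ ⟩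
    (y ᵀ ⨾ x ᵀ) ᵀ ∪ (z ᵀ ⨾ x ᵀ) ᵀ   ≡⟨ cong₂ _∪_ (ᵀ-distrib-⨾ᵀ y) (ᵀ-distrib-⨾ᵀ z) ⟩
    x ⨾ y ∪ x ⨾ z                   ∎
    where
      open ≡-Reasoning
      ᵀ-distrib-⨾ᵀ : ∀ w → (w ᵀ ⨾ x ᵀ) ᵀ ≡ x ⨾ w
      ᵀ-distrib-⨾ᵀ w = trans (ᵀ-distrib-⨾ _ _) (cong₂ _⨾_ (ᵀ-involutive x) (ᵀ-involutive w))

  ⨾-monoʳ : ∀ x {y z} → y ⊆ z → x ⨾ y ⊆ x ⨾ z
  ⨾-monoʳ x {y} {z} y⊆z = trans (sym (⨾-distribˡ x y z)) (cong (x ⨾_) y⊆z)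

  ⨾-mono : ∀ {x y z w} → x ⊆ y → z ⊆ w → x ⨾ z ⊆ y ⨾ w
  ⨾-mono {y = y} {z = z} x⊆y z⊆w = ⊆-trans (⨾-monoˡ z x⊆y) (⨾-monoʳ y z⊆w)

  ᵀ-I : I ᵀ ≡ I
  ᵀ-I = begin
    I ᵀ           ≡⟨ ⨾-identityʳ (I ᵀ) ⟨
    I ᵀ ⨾ I       ≡⟨ cong (I ᵀ ⨾_) (ᵀ-involutive I) ⟨
    I ᵀ ⨾ I ᵀ ᵀ   ≡⟨ ᵀ-distrib-⨾ (I ᵀ) I ⟨
    (I ᵀ ⨾ I) ᵀ   ≡⟨ cong _ᵀ (⨾-identityʳ (I ᵀ)) ⟩
    I ᵀ ᵀ         ≡⟨ ᵀ-involutive I ⟩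
    I             ∎
    where open ≡-Reasoning

  ⨾-identityˡ : ∀ x → I ⨾ x ≡ x
  ⨾-identityˡ x = begin
    I ⨾ x           ≡⟨ ᵀ-involutive _ ⟨
    (I ⨾ x) ᵀ ᵀ     ≡⟨ cong _ᵀ (ᵀ-distrib-⨾ I x) ⟩
    (x ᵀ ⨾ I ᵀ) ᵀ   ≡⟨ cong (λ w → (x ᵀ ⨾ w) ᵀ) ᵀ-I ⟩
    (x ᵀ ⨾ I) ᵀ     ≡⟨ cong _ᵀ (⨾-identityʳ _) ⟩
    x ᵀ ᵀ           ≡⟨ ᵀ-involutive x ⟩
    x               ∎
    where open ≡-Reasoning

  ᵀ-L : L ᵀ ≡ L
  ᵀ-L = ⊆-antisym (⊆-L _) (ᵀ⊆⇒⊆ᵀ (⊆-L (L ᵀ)))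

  schroeder-⊆ : ∀ {x y z} → x ⨾ y ⊆ z → x ᵀ ⨾ ∁ z ⊆ ∁ y
  schroeder-⊆ {x} {y} x⨾y⊆z = ⊆-trans (⨾-monoʳ (x ᵀ) (∁-antitone x⨾y⊆z)) (schroeder x y)

  ⊆⨾L : ∀ x → x ⊆ x ⨾ L
  ⊆⨾L x = subst (_⊆ x ⨾ L) (⨾-identityʳ x) (⨾-monoʳ x (⊆-L I))

  -- For X = r ∩ ∁(r ⨾ rᵀ ⨾ r), Schröder gives Xᵀ ⨾ X ⊆ ∁(rᵀ ⨾ r), so Xᵀ ⨾ X = O
  -- and then X ⊆ X ⨾ L ⊆ ∁ X, i.e. X = O.
  ⊆⨾ᵀ⨾ : ∀ r → r ⊆ r ⨾ r ᵀ ⨾ r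
  ⊆⨾ᵀ⨾ r = subst (_⊆ M) (sym (huntington r (∁ M))) (∪-least X⊆M (x∩y⊆y r M))
    where
      open ⊆-Reasoning
      M X : Carrier
      M = r ⨾ r ᵀ ⨾ r
      X = r ∩ ∁ M
      X⊆r : X ⊆ r
      X⊆r = x∩y⊆x r (∁ M)
      Xᵀ⨾X⊆∁[Xᵀ⨾X] : X ᵀ ⨾ X ⊆ ∁ (X ᵀ ⨾ X)
      Xᵀ⨾X⊆∁[Xᵀ⨾X] = begin
        X ᵀ ⨾ X                   ≤⟨ ⨾-mono (ᵀ-mono X⊆r) (x∩y⊆y r (∁ M)) ⟩
        r ᵀ ⨾ ∁ M                 ≡⟨ cong (λ w → r ᵀ ⨾ ∁ w) (⨾-assoc r (r ᵀ) r) ⟩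
        r ᵀ ⨾ ∁ (r ⨾ (r ᵀ ⨾ r))   ≤⟨ schroeder-⊆ ⊆-refl ⟩
        ∁ (r ᵀ ⨾ r)               ≤⟨ ∁-antitone (⨾-mono (ᵀ-mono X⊆r) X⊆r) ⟩
        ∁ (X ᵀ ⨾ X)               ∎
      X⊆∁X : X ⊆ ∁ X
      X⊆∁X = begin
        X              ≤⟨ ⊆⨾L X ⟩
        X ⨾ L          ≡⟨ cong₂ _⨾_ (ᵀ-involutive X) (∁-involutive L) ⟨
        X ᵀ ᵀ ⨾ ∁ (∁ L) ≤⟨ schroeder-⊆ (⊆-reflexive (⊆∁⇒≡∁L Xᵀ⨾X⊆∁[Xᵀ⨾X])) ⟩
        ∁ X            ∎
      X⊆M : X ⊆ M
      X⊆M = subst (_⊆ M) (sym (⊆∁⇒≡∁L X⊆∁X)) (∁L-⊆ M)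

  ᵀ⊆ᵀ⨾⨾ᵀ : ∀ r → r ᵀ ⊆ r ᵀ ⨾ r ⨾ r ᵀ
  ᵀ⊆ᵀ⨾⨾ᵀ r = subst (λ w → r ᵀ ⊆ r ᵀ ⨾ w ⨾ r ᵀ) (ᵀ-involutive r) (⊆⨾ᵀ⨾ (r ᵀ))

  ᵀ-distrib-⨾L⨾ : ∀ x y → (x ⨾ L ⨾ y) ᵀ ≡ y ᵀ ⨾ L ⨾ x ᵀ
  ᵀ-distrib-⨾L⨾ x y = begin
    (x ⨾ L ⨾ y) ᵀ       ≡⟨ ᵀ-distrib-⨾ _ _ ⟩
    y ᵀ ⨾ (x ⨾ L) ᵀ     ≡⟨ cong (y ᵀ ⨾_) (ᵀ-distrib-⨾ _ _) ⟩
    y ᵀ ⨾ (L ᵀ ⨾ x ᵀ)   ≡⟨ cong (λ w → y ᵀ ⨾ (w ⨾ x ᵀ)) ᵀ-L ⟩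
    y ᵀ ⨾ (L ⨾ x ᵀ)     ≡⟨ ⨾-assoc _ _ _ ⟨
    y ᵀ ⨾ L ⨾ x ᵀ       ∎
    where open ≡-Reasoning

  ⨾-absorb-L : ∀ {x y u z v w} m → x ⊆ y ⨾ u → z ⊆ v ⨾ w → x ⨾ m ⨾ z ⊆ y ⨾ L ⨾ w
  ⨾-absorb-L {x} {y} {u} {z} {v} {w} m x⊆y⨾u z⊆v⨾w = begin
    x ⨾ m ⨾ z                 ≤⟨ ⨾-mono (⨾-monoˡ m x⊆y⨾u) z⊆v⨾w ⟩
    y ⨾ u ⨾ m ⨾ (v ⨾ w)       ≡⟨ ⨾-assoc _ v w ⟨
    y ⨾ u ⨾ m ⨾ v ⨾ w         ≡⟨ cong (λ t → t ⨾ v ⨾ w) (⨾-assoc y u m) ⟩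
    y ⨾ (u ⨾ m) ⨾ v ⨾ w       ≡⟨ cong (_⨾ w) (⨾-assoc y (u ⨾ m) v) ⟩
    y ⨾ (u ⨾ m ⨾ v) ⨾ w       ≤⟨ ⨾-monoˡ w (⨾-monoʳ y (⊆-L _)) ⟩
    y ⨾ L ⨾ w                 ∎
    where open ⊆-Reasoning

  ⨾L⨾-absorbˡ : ∀ {x y u} z → x ⊆ y ⨾ u → x ⨾ L ⨾ z ⊆ y ⨾ L ⨾ z
  ⨾L⨾-absorbˡ z x⊆y⨾u = ⨾-absorb-L L x⊆y⨾u (⊆-reflexive (sym (⨾-identityˡ z)))

  ⨾L⨾-absorbʳ : ∀ {z v w} x → z ⊆ v ⨾ w → x ⨾ L ⨾ z ⊆ x ⨾ L ⨾ w
  ⨾L⨾-absorbʳ x z⊆v⨾w = ⨾-absorb-L L (⊆-reflexive (sym (⨾-identityʳ x))) z⊆v⨾w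

  ⨾L⨾-expandˡ : ∀ {x y} z → x ⊆ x ⨾ y ⨾ x → x ⨾ L ⨾ z ⊆ x ⨾ (y ⨾ L ⨾ z)
  ⨾L⨾-expandˡ {x} {y} z x⊆x⨾y⨾x = begin
    x ⨾ L ⨾ z               ≤⟨ ⨾-monoˡ z (⨾-monoˡ L x⊆x⨾y⨾x) ⟩
    x ⨾ y ⨾ x ⨾ L ⨾ z       ≡⟨ cong (_⨾ z) (⨾-assoc (x ⨾ y) x L) ⟩
    x ⨾ y ⨾ (x ⨾ L) ⨾ z     ≤⟨ ⨾-monoˡ z (⨾-monoʳ (x ⨾ y) (⊆-L _)) ⟩
    x ⨾ y ⨾ L ⨾ z           ≡⟨ cong (_⨾ z) (⨾-assoc x y L) ⟩
    x ⨾ (y ⨾ L) ⨾ z         ≡⟨ ⨾-assoc x _ z ⟩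
    x ⨾ (y ⨾ L ⨾ z)         ∎
    where open ⊆-Reasoning

  ⨾L⨾-expandʳ : ∀ {z y} x → z ⊆ z ⨾ y ⨾ z → x ⨾ L ⨾ z ⊆ x ⨾ L ⨾ y ⨾ z
  ⨾L⨾-expandʳ {z} {y} x z⊆z⨾y⨾z = begin
    x ⨾ L ⨾ z               ≤⟨ ⨾-monoʳ (x ⨾ L) z⊆z⨾y⨾z ⟩
    x ⨾ L ⨾ (z ⨾ y ⨾ z)     ≡⟨ ⨾-assoc (x ⨾ L) (z ⨾ y) z ⟨
    x ⨾ L ⨾ (z ⨾ y) ⨾ z     ≡⟨ cong (_⨾ z) (⨾-assoc (x ⨾ L) z y) ⟨
    x ⨾ L ⨾ z ⨾ y ⨾ z       ≤⟨ ⨾-monoˡ z (⨾-monoˡ y (⊆-trans (⊆-reflexive (⨾-assoc x L z)) (⨾-monoʳ x (⊆-L _)))) ⟩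
    x ⨾ L ⨾ y ⨾ z           ∎
    where open ⊆-Reasoning

  I⊆⋆ : ∀ r → I ⊆ r ⋆
  I⊆⋆ r = ⊆-trans (x⊆x∪y I _) (star-unfoldˡ r)

  ⁺⊆⋆ : ∀ r → r ⁺ ⊆ r ⋆
  ⁺⊆⋆ r = ⊆-trans (y⊆x∪y I _) (star-unfoldˡ r)

  ⋆⨾⊆⋆ : ∀ r → r ⋆ ⨾ r ⊆ r ⋆
  ⋆⨾⊆⋆ r = ⊆-trans (y⊆x∪y I _) (star-unfoldʳ r)

  ⊆⁺ : ∀ r → r ⊆ r ⁺
  ⊆⁺ r = subst (_⊆ r ⁺) (⨾-identityʳ r) (⨾-monoʳ r (I⊆⋆ r))

  ⋆-least : ∀ {r q} → I ⊆ q → r ⨾ q ⊆ q → r ⋆ ⊆ q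
  ⋆-least {r} {q} I⊆q r⨾q⊆q = subst (_⊆ q) (⨾-identityʳ _) (star-inductˡ r I q (∪-least I⊆q r⨾q⊆q))

  ⋆⨾⋆⊆⋆ : ∀ r → r ⋆ ⨾ r ⋆ ⊆ r ⋆
  ⋆⨾⋆⊆⋆ r = star-inductˡ r (r ⋆) (r ⋆) (∪-least ⊆-refl (⁺⊆⋆ r))

  ⊆⋆⇒⋆⊆⋆ : ∀ {x r} → x ⊆ r ⋆ → x ⋆ ⊆ r ⋆
  ⊆⋆⇒⋆⊆⋆ {x} {r} x⊆r⋆ = ⋆-least (I⊆⋆ r) (⊆-trans (⨾-monoˡ (r ⋆) x⊆r⋆) (⋆⨾⋆⊆⋆ r))

  ⋆⨾≡⁺ : ∀ r → r ⋆ ⨾ r ≡ r ⁺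
  ⋆⨾≡⁺ r = ⊆-antisym
    (star-inductˡ r r (r ⁺) (∪-least (⊆⁺ r) (⨾-monoʳ r (⁺⊆⋆ r))))
    (star-inductʳ r r (r ⋆ ⨾ r) (∪-least r⊆⋆⨾r (⨾-monoˡ r (⋆⨾⊆⋆ r))))
    where
      r⊆⋆⨾r : r ⊆ r ⋆ ⨾ r
      r⊆⋆⨾r = subst (_⊆ r ⋆ ⨾ r) (⨾-identityˡ r) (⨾-monoˡ r (I⊆⋆ r))

  ⋆⨾⨾⋆⊆⁺ : ∀ r → r ⋆ ⨾ r ⨾ r ⋆ ⊆ r ⁺
  ⋆⨾⨾⋆⊆⁺ r = begin
    r ⋆ ⨾ r ⨾ r ⋆     ≡⟨ cong (_⨾ r ⋆) (⋆⨾≡⁺ r) ⟩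
    r ⨾ r ⋆ ⨾ r ⋆     ≡⟨ ⨾-assoc _ _ _ ⟩
    r ⨾ (r ⋆ ⨾ r ⋆)   ≤⟨ ⨾-monoʳ r (⋆⨾⋆⊆⋆ r) ⟩
    r ⁺               ∎
    where open ⊆-Reasoning

  ⋆⊆ᵀ⋆ᵀ : ∀ r → r ⋆ ⊆ r ᵀ ⋆ ᵀ
  ⋆⊆ᵀ⋆ᵀ r = ⋆-least (subst (_⊆ r ᵀ ⋆ ᵀ) ᵀ-I (ᵀ-mono (I⊆⋆ (r ᵀ)))) r⨾ᵀ⋆ᵀ⊆ᵀ⋆ᵀ
    where
      r⨾ᵀ⋆ᵀ⊆ᵀ⋆ᵀ : r ⨾ r ᵀ ⋆ ᵀ ⊆ r ᵀ ⋆ ᵀ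
      r⨾ᵀ⋆ᵀ⊆ᵀ⋆ᵀ = subst (_⊆ r ᵀ ⋆ ᵀ)
        (trans (ᵀ-distrib-⨾ _ _) (cong (_⨾ r ᵀ ⋆ ᵀ) (ᵀ-involutive r)))
        (ᵀ-mono (⋆⨾⊆⋆ (r ᵀ)))

  ᵀ-⋆ : ∀ r → r ⋆ ᵀ ≡ r ᵀ ⋆
  ᵀ-⋆ r = ⊆-antisym (⊆ᵀ⇒ᵀ⊆ (⋆⊆ᵀ⋆ᵀ r))
    (subst (λ w → r ᵀ ⋆ ⊆ w ⋆ ᵀ) (ᵀ-involutive r) (⋆⊆ᵀ⋆ᵀ (r ᵀ)))

  ᵀ-⁺ : ∀ r → r ⁺ ᵀ ≡ r ᵀ ⁺
  ᵀ-⁺ r = begin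
    r ⁺ ᵀ           ≡⟨ ᵀ-distrib-⨾ r (r ⋆) ⟩
    r ⋆ ᵀ ⨾ r ᵀ     ≡⟨ cong (_⨾ r ᵀ) (ᵀ-⋆ r) ⟩
    r ᵀ ⋆ ⨾ r ᵀ     ≡⟨ ⋆⨾≡⁺ (r ᵀ) ⟩
    r ᵀ ⁺           ∎
    where open ≡-Reasoning

  ᵀ⊆ᵀ⨾L⨾ᵀ : ∀ r → r ᵀ ⊆ r ᵀ ⨾ L ⨾ r ᵀ
  ᵀ⊆ᵀ⨾L⨾ᵀ r = ⊆-trans (ᵀ⊆ᵀ⨾⨾ᵀ r) (⨾-monoˡ (r ᵀ) (⨾-monoʳ (r ᵀ) (⊆-L r)))

  ᵀ⨾L⨾-symmetric : ∀ r → (r ᵀ ⨾ L ⨾ r) ᵀ ≡ r ᵀ ⨾ L ⨾ r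
  ᵀ⨾L⨾-symmetric r = trans (ᵀ-distrib-⨾L⨾ (r ᵀ) r) (cong (r ᵀ ⨾ L ⨾_) (ᵀ-involutive r))

  ⨾L⨾ᵀ-symmetric : ∀ r → (r ⨾ L ⨾ r ᵀ) ᵀ ≡ r ⨾ L ⨾ r ᵀ
  ⨾L⨾ᵀ-symmetric r = trans (ᵀ-distrib-⨾L⨾ r (r ᵀ)) (cong (λ w → w ⨾ L ⨾ r ᵀ) (ᵀ-involutive r))

  injective⇒⁺⨾ᵀ⊆⋆ : ∀ {r} → injective r → r ⁺ ⨾ r ᵀ ⊆ r ⋆
  injective⇒⁺⨾ᵀ⊆⋆ {r} r⨾rᵀ⊆I = begin
    r ⁺ ⨾ r ᵀ         ≡⟨ cong (_⨾ r ᵀ) (⋆⨾≡⁺ r) ⟨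
    r ⋆ ⨾ r ⨾ r ᵀ     ≡⟨ ⨾-assoc _ _ _ ⟩
    r ⋆ ⨾ (r ⨾ r ᵀ)   ≤⟨ ⨾-monoʳ (r ⋆) r⨾rᵀ⊆I ⟩
    r ⋆ ⨾ I           ≡⟨ ⨾-identityʳ _ ⟩
    r ⋆               ∎
    where open ⊆-Reasoning

  univalent⇒ᵀ⨾⁺⊆⋆ : ∀ {r} → univalent r → r ᵀ ⨾ r ⁺ ⊆ r ⋆
  univalent⇒ᵀ⨾⁺⊆⋆ {r} rᵀ⨾r⊆I = begin
    r ᵀ ⨾ r ⁺         ≡⟨ ⨾-assoc _ _ _ ⟨
    r ᵀ ⨾ r ⨾ r ⋆     ≤⟨ ⨾-monoˡ (r ⋆) rᵀ⨾r⊆I ⟩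
    I ⨾ r ⋆           ≡⟨ ⨾-identityˡ _ ⟩
    r ⋆               ∎
    where open ⊆-Reasoning

  -- In the names below ᵀLR stands for R ᵀ ⨾ L ⨾ R, RLᵀ for R ⨾ L ⨾ R ᵀ, and so on.
  module Characterisation (R : Carrier) where

    connected⇒ᵀLᵀ⊆⋆ : connected R × R ⋆ ≡ R ᵀ ⋆ → R ᵀ ⨾ L ⨾ R ᵀ ⊆ R ⋆
    connected⇒ᵀLᵀ⊆⋆ (RLR⊆⋆∪ᵀ⋆ , ⋆≡ᵀ⋆) = begin
      R ᵀ ⨾ L ⨾ R ᵀ       ≡⟨ ᵀ-distrib-⨾L⨾ R R ⟨
      (R ⨾ L ⨾ R) ᵀ       ≤⟨ ᵀ-mono RLR⊆⋆∪ᵀ⋆ ⟩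
      (R ⋆ ∪ R ᵀ ⋆) ᵀ     ≡⟨ cong (λ w → (w ∪ R ᵀ ⋆) ᵀ) ⋆≡ᵀ⋆ ⟩
      (R ᵀ ⋆ ∪ R ᵀ ⋆) ᵀ   ≡⟨ cong _ᵀ (∪-idem _) ⟩
      R ᵀ ⋆ ᵀ             ≡⟨ ᵀ-⋆ (R ᵀ) ⟩
      R ᵀ ᵀ ⋆             ≡⟨ cong _⋆ (ᵀ-involutive R) ⟩
      R ⋆                 ∎
      where open ⊆-Reasoning

    ᵀLᵀ⊆⋆⇒connected : R ᵀ ⨾ L ⨾ R ᵀ ⊆ R ⋆ → connected R × R ⋆ ≡ R ᵀ ⋆
    ᵀLᵀ⊆⋆⇒connected ᵀLᵀ⊆⋆ = RLR⊆⋆∪ᵀ⋆ , ⊆-antisym (⊆⋆⇒⋆⊆⋆ R⊆ᵀ⋆) (⊆⋆⇒⋆⊆⋆ ᵀ⊆⋆)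
      where
        open ⊆-Reasoning
        ᵀ⊆⋆ : R ᵀ ⊆ R ⋆
        ᵀ⊆⋆ = ⊆-trans (ᵀ⊆ᵀ⨾L⨾ᵀ R) ᵀLᵀ⊆⋆
        R⊆ᵀ⋆ : R ⊆ R ᵀ ⋆
        R⊆ᵀ⋆ = subst (R ⊆_) (ᵀ-⋆ R) (ᵀ⊆⇒⊆ᵀ ᵀ⊆⋆)
        RLR⊆⋆∪ᵀ⋆ : R ⨾ L ⨾ R ⊆ R ⋆ ∪ R ᵀ ⋆
        RLR⊆⋆∪ᵀ⋆ = begin
          R ⨾ L ⨾ R       ≤⟨ ᵀ⊆⇒⊆ᵀ (subst (_⊆ R ⋆) (sym (ᵀ-distrib-⨾L⨾ R R)) ᵀLᵀ⊆⋆) ⟩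
          R ⋆ ᵀ           ≡⟨ ᵀ-⋆ R ⟩
          R ᵀ ⋆           ≤⟨ y⊆x∪y _ _ ⟩
          R ⋆ ∪ R ᵀ ⋆     ∎

    connected⇔ᵀLᵀ⊆⋆ : (connected R × R ⋆ ≡ R ᵀ ⋆) ⇔ (R ᵀ ⨾ L ⨾ R ᵀ ⊆ R ⋆)
    connected⇔ᵀLᵀ⊆⋆ = mk⇔ connected⇒ᵀLᵀ⊆⋆ ᵀLᵀ⊆⋆⇒connected

    ᵀLᵀ⊆⋆⇒ᵀLᵀ⊆⁺ : R ᵀ ⨾ L ⨾ R ᵀ ⊆ R ⋆ → R ᵀ ⨾ L ⨾ R ᵀ ⊆ R ⁺
    ᵀLᵀ⊆⋆⇒ᵀLᵀ⊆⁺ ᵀLᵀ⊆⋆ = begin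
      R ᵀ ⨾ L ⨾ R ᵀ               ≤⟨ ⨾-monoʳ (R ᵀ ⨾ L) (ᵀ⊆ᵀ⨾⨾ᵀ R) ⟩
      R ᵀ ⨾ L ⨾ (R ᵀ ⨾ R ⨾ R ᵀ)   ≡⟨ ⨾-assoc (R ᵀ ⨾ L) (R ᵀ ⨾ R) (R ᵀ) ⟨
      R ᵀ ⨾ L ⨾ (R ᵀ ⨾ R) ⨾ R ᵀ   ≡⟨ cong (_⨾ R ᵀ) (⨾-assoc (R ᵀ ⨾ L) (R ᵀ) R) ⟨
      R ᵀ ⨾ L ⨾ R ᵀ ⨾ R ⨾ R ᵀ     ≤⟨ ⨾-mono (⨾-monoˡ R ᵀLᵀ⊆⋆) (⊆-trans (ᵀ⊆ᵀ⨾L⨾ᵀ R) ᵀLᵀ⊆⋆) ⟩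
      R ⋆ ⨾ R ⨾ R ⋆               ≤⟨ ⋆⨾⨾⋆⊆⁺ R ⟩
      R ⁺                         ∎
      where open ⊆-Reasoning

    ᵀLᵀ⊆⋆⇔ᵀLᵀ⊆⁺ : (R ᵀ ⨾ L ⨾ R ᵀ ⊆ R ⋆) ⇔ (R ᵀ ⨾ L ⨾ R ᵀ ⊆ R ⁺)
    ᵀLᵀ⊆⋆⇔ᵀLᵀ⊆⁺ = mk⇔ ᵀLᵀ⊆⋆⇒ᵀLᵀ⊆⁺ (λ ᵀLᵀ⊆⁺ → ⊆-trans ᵀLᵀ⊆⁺ (⁺⊆⋆ R))

    connected⇔ᵀLᵀ⊆⁺ : (connected R × R ⋆ ≡ R ᵀ ⋆) ⇔ (R ᵀ ⨾ L ⨾ R ᵀ ⊆ R ⁺)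
    connected⇔ᵀLᵀ⊆⁺ = ᵀLᵀ⊆⋆⇔ᵀLᵀ⊆⁺ ⇔-∘ connected⇔ᵀLᵀ⊆⋆

    module ConverseInPlus (ᵀ⊆⁺ : R ᵀ ⊆ R ⁺) where

      ᵀ⊆⋆⨾ : R ᵀ ⊆ R ⋆ ⨾ R
      ᵀ⊆⋆⨾ = subst (R ᵀ ⊆_) (sym (⋆⨾≡⁺ R)) ᵀ⊆⁺

      ⊆ᵀ⁺ : R ⊆ R ᵀ ⁺
      ⊆ᵀ⁺ = subst (R ⊆_) (ᵀ-⁺ R) (ᵀ⊆⇒⊆ᵀ ᵀ⊆⁺)

      ⊆ᵀ⋆⨾ᵀ : R ⊆ R ᵀ ⋆ ⨾ R ᵀ
      ⊆ᵀ⋆⨾ᵀ = subst (R ⊆_) (sym (⋆⨾≡⁺ (R ᵀ))) ⊆ᵀ⁺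

      ᵀLR⊆ᵀLᵀ : R ᵀ ⨾ L ⨾ R ⊆ R ᵀ ⨾ L ⨾ R ᵀ
      ᵀLR⊆ᵀLᵀ = ⨾L⨾-absorbʳ (R ᵀ) ⊆ᵀ⋆⨾ᵀ

      RLᵀ⊆ᵀLᵀ : R ⨾ L ⨾ R ᵀ ⊆ R ᵀ ⨾ L ⨾ R ᵀ
      RLᵀ⊆ᵀLᵀ = ⨾L⨾-absorbˡ (R ᵀ) ⊆ᵀ⁺

      RLR⊆ᵀLᵀ : R ⨾ L ⨾ R ⊆ R ᵀ ⨾ L ⨾ R ᵀ
      RLR⊆ᵀLᵀ = ⊆-trans (⨾L⨾-absorbˡ R ⊆ᵀ⁺) ᵀLR⊆ᵀLᵀ

      ᵀLᵀ⊆ᵀLR : R ᵀ ⨾ L ⨾ R ᵀ ⊆ R ᵀ ⨾ L ⨾ R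
      ᵀLᵀ⊆ᵀLR = ⨾L⨾-absorbʳ (R ᵀ) ᵀ⊆⋆⨾

      ᵀLᵀ⊆RLᵀ : R ᵀ ⨾ L ⨾ R ᵀ ⊆ R ⨾ L ⨾ R ᵀ
      ᵀLᵀ⊆RLᵀ = ⨾L⨾-absorbˡ (R ᵀ) ᵀ⊆⁺

      ⁺⊆ᵀLᵀ : R ⁺ ⊆ R ᵀ ⨾ L ⨾ R ᵀ
      ⁺⊆ᵀLᵀ = begin
        R ⁺                     ≤⟨ ⨾-monoˡ (R ⋆) (⊆⨾ᵀ⨾ R) ⟩
        R ⨾ R ᵀ ⨾ R ⨾ R ⋆       ≡⟨ ⨾-assoc (R ⨾ R ᵀ) R (R ⋆) ⟩
        R ⨾ R ᵀ ⨾ R ⁺           ≤⟨ ⨾-absorb-L (R ᵀ) ⊆ᵀ⁺ ⁺⊆⋆⨾ᵀ⋆⨾ᵀ ⟩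
        R ᵀ ⨾ L ⨾ R ᵀ           ∎
        where
          open ⊆-Reasoning
          ⁺⊆⋆⨾ᵀ⋆⨾ᵀ : R ⁺ ⊆ R ⋆ ⨾ R ᵀ ⋆ ⨾ R ᵀ
          ⁺⊆⋆⨾ᵀ⋆⨾ᵀ = begin
            R ⁺                     ≡⟨ ⋆⨾≡⁺ R ⟨
            R ⋆ ⨾ R                 ≤⟨ ⨾-monoʳ (R ⋆) ⊆ᵀ⋆⨾ᵀ ⟩
            R ⋆ ⨾ (R ᵀ ⋆ ⨾ R ᵀ)     ≡⟨ ⨾-assoc _ _ _ ⟨
            R ⋆ ⨾ R ᵀ ⋆ ⨾ R ᵀ       ∎

    open ConverseInPlus

    ᵀLᵀ⊆⁺⇒ᵀ⊆⁺ : R ᵀ ⨾ L ⨾ R ᵀ ⊆ R ⁺ → R ᵀ ⊆ R ⁺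
    ᵀLᵀ⊆⁺⇒ᵀ⊆⁺ = ⊆-trans (ᵀ⊆ᵀ⨾L⨾ᵀ R)

    symmetric≡⁺⇒ᵀ⊆⁺ : ∀ {s} → s ᵀ ≡ s → s ≡ R ⁺ → R ᵀ ⊆ R ⁺
    symmetric≡⁺⇒ᵀ⊆⁺ sᵀ≡s s≡⁺ =
      subst (R ᵀ ⊆_) (trans sᵀ≡s s≡⁺) (ᵀ-mono (subst (R ⊆_) (sym s≡⁺) (⊆⁺ R)))

    ᵀLᵀ⊆⁺⇔ᵀLᵀ≡⁺ : (R ᵀ ⨾ L ⨾ R ᵀ ⊆ R ⁺) ⇔ (R ᵀ ⨾ L ⨾ R ᵀ ≡ R ⁺)
    ᵀLᵀ⊆⁺⇔ᵀLᵀ≡⁺ = mk⇔ (λ p → ⊆-antisym p (⁺⊆ᵀLᵀ (ᵀLᵀ⊆⁺⇒ᵀ⊆⁺ p))) ⊆-reflexive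

    ᵀLᵀ⊆⁺⇔ᵀLR≡⁺ : (R ᵀ ⨾ L ⨾ R ᵀ ⊆ R ⁺) ⇔ (R ᵀ ⨾ L ⨾ R ≡ R ⁺)
    ᵀLᵀ⊆⁺⇔ᵀLR≡⁺ = mk⇔
      (λ p → let ᵀ⊆⁺ = ᵀLᵀ⊆⁺⇒ᵀ⊆⁺ p in
             ⊆-antisym (⊆-trans (ᵀLR⊆ᵀLᵀ ᵀ⊆⁺) p) (⊆-trans (⁺⊆ᵀLᵀ ᵀ⊆⁺) (ᵀLᵀ⊆ᵀLR ᵀ⊆⁺)))
      (λ eq → ⊆-trans (ᵀLᵀ⊆ᵀLR (symmetric≡⁺⇒ᵀ⊆⁺ (ᵀ⨾L⨾-symmetric R) eq)) (⊆-reflexive eq))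

    ᵀLᵀ⊆⁺⇔RLᵀ≡⁺ : (R ᵀ ⨾ L ⨾ R ᵀ ⊆ R ⁺) ⇔ (R ⨾ L ⨾ R ᵀ ≡ R ⁺)
    ᵀLᵀ⊆⁺⇔RLᵀ≡⁺ = mk⇔
      (λ p → let ᵀ⊆⁺ = ᵀLᵀ⊆⁺⇒ᵀ⊆⁺ p in
             ⊆-antisym (⊆-trans (RLᵀ⊆ᵀLᵀ ᵀ⊆⁺) p) (⊆-trans (⁺⊆ᵀLᵀ ᵀ⊆⁺) (ᵀLᵀ⊆RLᵀ ᵀ⊆⁺)))
      (λ eq → ⊆-trans (ᵀLᵀ⊆RLᵀ (symmetric≡⁺⇒ᵀ⊆⁺ (⨾L⨾ᵀ-symmetric R) eq)) (⊆-reflexive eq))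

    ᵀLᵀ⊆⁺⇒RLR⊆⁺ : R ᵀ ⨾ L ⨾ R ᵀ ⊆ R ⁺ → R ⨾ L ⨾ R ⊆ R ⁺
    ᵀLᵀ⊆⁺⇒RLR⊆⁺ p = ⊆-trans (RLR⊆ᵀLᵀ (ᵀLᵀ⊆⁺⇒ᵀ⊆⁺ p)) p

    ᵀLR≡⁺⇒RLR⊆R⨾⁺ : R ᵀ ⨾ L ⨾ R ≡ R ⁺ → R ⨾ L ⨾ R ⊆ R ⨾ R ⁺
    ᵀLR≡⁺⇒RLR⊆R⨾⁺ eq = ⊆-trans (⨾L⨾-expandˡ R (⊆⨾ᵀ⨾ R)) (⨾-monoʳ R (⊆-reflexive eq))

    injective⇒ᵀLR⊆⁺⇒ᵀLᵀ⊆⋆ : injective R → R ᵀ ⨾ L ⨾ R ⊆ R ⁺ → R ᵀ ⨾ L ⨾ R ᵀ ⊆ R ⋆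
    injective⇒ᵀLR⊆⁺⇒ᵀLᵀ⊆⋆ inj ᵀLR⊆⁺ = begin
      R ᵀ ⨾ L ⨾ R ᵀ       ≤⟨ ⨾L⨾-expandʳ (R ᵀ) (ᵀ⊆ᵀ⨾⨾ᵀ R) ⟩
      R ᵀ ⨾ L ⨾ R ⨾ R ᵀ   ≤⟨ ⨾-monoˡ (R ᵀ) ᵀLR⊆⁺ ⟩
      R ⁺ ⨾ R ᵀ           ≤⟨ injective⇒⁺⨾ᵀ⊆⋆ inj ⟩
      R ⋆                 ∎
      where open ⊆-Reasoning

    univalent⇒RLᵀ⊆⁺⇒ᵀLᵀ⊆⋆ : univalent R → R ⨾ L ⨾ R ᵀ ⊆ R ⁺ → R ᵀ ⨾ L ⨾ R ᵀ ⊆ R ⋆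
    univalent⇒RLᵀ⊆⁺⇒ᵀLᵀ⊆⋆ uni RLᵀ⊆⁺ = begin
      R ᵀ ⨾ L ⨾ R ᵀ         ≤⟨ ⨾L⨾-expandˡ (R ᵀ) (ᵀ⊆ᵀ⨾⨾ᵀ R) ⟩
      R ᵀ ⨾ (R ⨾ L ⨾ R ᵀ)   ≤⟨ ⨾-monoʳ (R ᵀ) RLᵀ⊆⁺ ⟩
      R ᵀ ⨾ R ⁺             ≤⟨ univalent⇒ᵀ⨾⁺⊆⋆ uni ⟩
      R ⋆                   ∎
      where open ⊆-Reasoning

    mapping⇒RLR⊆R⨾⁺⇒ᵀLᵀ⊆⋆ : injective R → univalent R → R ⨾ L ⨾ R ⊆ R ⨾ R ⁺ →
                             R ᵀ ⨾ L ⨾ R ᵀ ⊆ R ⋆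
    mapping⇒RLR⊆R⨾⁺⇒ᵀLᵀ⊆⋆ inj uni RLR⊆R⨾⁺ = begin
      R ᵀ ⨾ L ⨾ R ᵀ                 ≤⟨ ⨾L⨾-expandˡ (R ᵀ) (ᵀ⊆ᵀ⨾⨾ᵀ R) ⟩
      R ᵀ ⨾ (R ⨾ L ⨾ R ᵀ)           ≤⟨ ⨾-monoʳ (R ᵀ) (⨾L⨾-expandʳ R (ᵀ⊆ᵀ⨾⨾ᵀ R)) ⟩
      R ᵀ ⨾ (R ⨾ L ⨾ R ⨾ R ᵀ)       ≤⟨ ⨾-monoʳ (R ᵀ) (⨾-monoˡ (R ᵀ) RLR⊆R⨾⁺) ⟩
      R ᵀ ⨾ (R ⨾ R ⁺ ⨾ R ᵀ)         ≡⟨ cong (R ᵀ ⨾_) (⨾-assoc R (R ⁺) (R ᵀ)) ⟩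
      R ᵀ ⨾ (R ⨾ (R ⁺ ⨾ R ᵀ))       ≡⟨ ⨾-assoc (R ᵀ) R (R ⁺ ⨾ R ᵀ) ⟨
      R ᵀ ⨾ R ⨾ (R ⁺ ⨾ R ᵀ)         ≤⟨ ⨾-monoˡ (R ⁺ ⨾ R ᵀ) uni ⟩
      I ⨾ (R ⁺ ⨾ R ᵀ)               ≡⟨ ⨾-identityˡ _ ⟩
      R ⁺ ⨾ R ᵀ                     ≤⟨ injective⇒⁺⨾ᵀ⊆⋆ inj ⟩
      R ⋆                           ∎
      where open ⊆-Reasoning

    connected⇔ᵀLR≡⁺ : (connected R × R ⋆ ≡ R ᵀ ⋆) ⇔ (R ᵀ ⨾ L ⨾ R ≡ R ⁺)
    connected⇔ᵀLR≡⁺ = ᵀLᵀ⊆⁺⇔ᵀLR≡⁺ ⇔-∘ connected⇔ᵀLᵀ⊆⁺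

    connected⇔RLᵀ≡⁺ : (connected R × R ⋆ ≡ R ᵀ ⋆) ⇔ (R ⨾ L ⨾ R ᵀ ≡ R ⁺)
    connected⇔RLᵀ≡⁺ = ᵀLᵀ⊆⁺⇔RLᵀ≡⁺ ⇔-∘ connected⇔ᵀLᵀ⊆⁺

    connected⇒ᵀLR⊆⁺ : connected R × R ⋆ ≡ R ᵀ ⋆ → R ᵀ ⨾ L ⨾ R ⊆ R ⁺
    connected⇒ᵀLR⊆⁺ = ⊆-reflexive ∘ to connected⇔ᵀLR≡⁺

    connected⇒RLᵀ⊆⁺ : connected R × R ⋆ ≡ R ᵀ ⋆ → R ⨾ L ⨾ R ᵀ ⊆ R ⁺
    connected⇒RLᵀ⊆⁺ = ⊆-reflexive ∘ to connected⇔RLᵀ≡⁺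

    connected⇒RLR⊆R⨾⁺ : connected R × R ⋆ ≡ R ᵀ ⋆ → R ⨾ L ⨾ R ⊆ R ⨾ R ⁺
    connected⇒RLR⊆R⨾⁺ = ᵀLR≡⁺⇒RLR⊆R⨾⁺ ∘ to connected⇔ᵀLR≡⁺

    connected⇒RLR⊆⁺ : connected R × R ⋆ ≡ R ᵀ ⋆ → R ⨾ L ⨾ R ⊆ R ⁺
    connected⇒RLR⊆⁺ = ᵀLᵀ⊆⁺⇒RLR⊆⁺ ∘ to connected⇔ᵀLᵀ⊆⁺

mainTheorem9 : ∀ {c : Level} (A : KleeneRelationAlgebra c) → let open KRA A in
    ∀ (R : Carrier) →
    let P1 = connected R × (R ⋆ ≡ R ᵀ ⋆)
        P2 = R ᵀ ⨾ L ⨾ R ᵀ ⊆ R ⋆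
        P3 = R ᵀ ⨾ L ⨾ R ᵀ ⊆ R ⁺
        P4 = R ᵀ ⨾ L ⨾ R ᵀ ≡ R ⁺
        P5 = R ᵀ ⨾ L ⨾ R ≡ R ⁺
        P6 = R ⨾ L ⨾ R ᵀ ≡ R ⁺
        P7 = R ᵀ ⨾ L ⨾ R ⊆ R ⁺
        P8 = R ⨾ L ⨾ R ᵀ ⊆ R ⁺
        P9 = R ⨾ L ⨾ R ⊆ R ⨾ R ⁺
        P10 = R ⨾ L ⨾ R ⊆ R ⁺
    in (P1 ⇔ P2) × (P1 ⇔ P3) × (P1 ⇔ P4) × (P1 ⇔ P5) × (P1 ⇔ P6)
       × (P1 → P7) × (P1 → P8) × (P1 → P9) × (P1 → P10)
       × (injective R → (P7 ⇔ P1))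
       × (univalent R → (P8 ⇔ P1))
       × (injective R → univalent R → (P9 ⇔ P1))
mainTheorem9 A R =
    connected⇔ᵀLᵀ⊆⋆
  , connected⇔ᵀLᵀ⊆⁺
  , ᵀLᵀ⊆⁺⇔ᵀLᵀ≡⁺ ⇔-∘ connected⇔ᵀLᵀ⊆⁺
  , connected⇔ᵀLR≡⁺
  , connected⇔RLᵀ≡⁺
  , connected⇒ᵀLR⊆⁺
  , connected⇒RLᵀ⊆⁺
  , connected⇒RLR⊆R⨾⁺
  , connected⇒RLR⊆⁺
  , (λ inj → mk⇔ (from connected⇔ᵀLᵀ⊆⋆ ∘ injective⇒ᵀLR⊆⁺⇒ᵀLᵀ⊆⋆ inj) connected⇒ᵀLR⊆⁺)
  , (λ uni → mk⇔ (from connected⇔ᵀLᵀ⊆⋆ ∘ univalent⇒RLᵀ⊆⁺⇒ᵀLᵀ⊆⋆ uni) connected⇒RLᵀ⊆⁺)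
  , (λ inj uni →
       mk⇔ (from connected⇔ᵀLᵀ⊆⋆ ∘ mapping⇒RLR⊆R⨾⁺⇒ᵀLᵀ⊆⋆ inj uni) connected⇒RLR⊆R⨾⁺)
  where
    open Properties A using (module Characterisation)
    open Characterisation R
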